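{- Let $B(p,q)=\frac{1-\sqrt{1-4p}}{2}+\frac{1-\sqrt{1-4q}}{2}\in\mathbb{Q}[[p,q]]$. Then for all integers $r,s\ge0$ with $(r,s)\neq(0,0)$, $$[p^rq^s]\log\left(\frac{1}{1-B(p,q)}\right)=\frac{1}{2(r+s)}\binom{2r}{r}\binom{2s}{s},$$ where $[p^rq^s]F$ denotes the coefficient of $p^rq^s$ in the formal power series $F$. -}

module Defs where

open import Data.Nat as ℕ using (ℕ; zero; suc; _∸_)
open import Data.Integer using (+_)
open import Data.Rational using (ℚ; _+_; _*_; _-_; -_; _/_; 0ℚ; 1ℚ; ½)

ℕ→ℚ : ℕ → ℚ
ℕ→ℚ n = + n / 1

-- reciprocal of a natural number (convention: inv 0 = 0; only used at nonzero arguments)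
inv : ℕ → ℚ
inv zero    = 0ℚ
inv (suc n) = + 1 / suc n

sumTo : ℕ → (ℕ → ℚ) → ℚ
sumTo zero    f = f zero
sumTo (suc n) f = sumTo n f + f (suc n)

-- Formal power series in two variables p, q over ℚ:
-- F r s is the coefficient [p^r q^s] F.
Series2 : Set
Series2 = ℕ → ℕ → ℚ

const : ℚ → Series2
const c zero zero = c
const c _    _    = 0ℚ

varP : Series2
varP (suc zero) zero = 1ℚ
varP _          _    = 0ℚ

varQ : Series2
varQ zero (suc zero) = 1ℚ
varQ _    _          = 0ℚ

_⊕_ : Series2 → Series2 → Series2
(F ⊕ G) r s = F r s + G r s

_⊖_ : Series2 → Series2 → Series2
(F ⊖ G) r s = F r s - G r s

scale : ℚ → Series2 → Series2
scale c F r s = c * F r s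

_⊛_ : Series2 → Series2 → Series2
(F ⊛ G) r s = sumTo r (λ i → sumTo s (λ j → F i j * G (r ∸ i) (s ∸ j)))

pow : Series2 → ℕ → Series2
pow F zero    = const 1ℚ
pow F (suc k) = F ⊛ pow F k

-- Composition f(G) of a univariate power series f = Σ a_k x^k (given by its
-- coefficients a) with a bivariate series G having zero constant term.
-- Since G^k has no terms of total degree < k, the coefficient of p^r q^s is
-- the finite sum Σ_{k=0}^{r+s} a_k [p^r q^s] G^k.
compose : (ℕ → ℚ) → Series2 → Series2
compose a G r s = sumTo (r ℕ.+ s) (λ k → a k * pow G k r s)

gbinom : ℚ → ℕ → ℚ
gbinom α zero    = 1ℚ
gbinom α (suc k) = gbinom α k * (α - ℕ→ℚ k) * inv (suc k)

-- square root of a series F with constant term 1: √F = (1 + (F-1))^{1/2}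
-- given by the binomial series Σ_k binom(1/2,k) (F-1)^k
sqrtS : Series2 → Series2
sqrtS F = compose (gbinom ½) (F ⊖ const 1ℚ)

-- log(1/(1-x)) = Σ_{k≥1} x^k / k
logInvOneMinusCoeff : ℕ → ℚ
logInvOneMinusCoeff k = inv k

logInvOneMinus : Series2 → Series2
logInvOneMinus G = compose logInvOneMinusCoeff G

halfOneMinusSqrt : Series2 → Series2
halfOneMinusSqrt X = scale ½ (const 1ℚ ⊖ sqrtS (const 1ℚ ⊖ scale (ℕ→ℚ 4) X))

B : Series2
B = halfOneMinusSqrt varP ⊕ halfOneMinusSqrt varQ

-- With c(x) = (1 - √(1-4x))/2 and A(x) = Σₖ C(2k,k) xᵏ one has B = c(p) + c(q),
-- √(1-4x)·A = 1 and √(1-4x) = (1-4x)·A; the first follows from E(√(1-4x)·A) = 0 for the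
-- Euler operator E = x d/dx, using the recurrences of the coefficients of A and of √(1-4x).
-- On ℚ[[p,q]] the Euler operator multiplies the coefficient of pʳqˢ by r+s and is a
-- derivation with E c(p) = p·A(p), so these identities give E B = (1-B)·½(A(p)A(q) - 1).
-- Hence E log(1/(1-B)) = E B/(1-B) = ½(A(p)A(q) - 1), whose coefficient of pʳqˢ is
-- ½ C(2r,r) C(2s,s); dividing by r+s gives the claim.

module Submission where

open import Level using (_⊔_)
open import Algebra.Bundles using (CommutativeRing; RawRing)
open import Algebra.Morphism.Structures using (IsRingHomomorphism)
open import Data.Nat as ℕ using (ℕ; zero; suc; _∸_; _≤_; _<_; z≤n; s≤s)
import Data.Nat.Properties as ℕ
open import Relation.Nullary using (¬_; yes; no; contradiction)
open import Data.Product using (_,_)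
open import Relation.Binary.PropositionalEquality as ≡ using (_≡_; _≢_)
open import Relation.Binary.Definitions using (WeaklyDecidable)
open import Data.Maybe using (just; nothing)
open import Algebra.Solver.Ring.AlmostCommutativeRing
  using (_-Raw-AlmostCommutative⟶_; fromCommutativeRing; Induced-equivalence)
import Algebra.Morphism.Construct.Composition as Composition
open import Data.Rational as ℚ using (ℚ; 0ℚ; 1ℚ; ½)
import Data.Rational.Properties as ℚ
open import Data.Rational.Unnormalised as ℚᵘ using (mkℚᵘ; *≡*)
import Data.Rational.Unnormalised.Properties as ℚᵘ
open import Data.Integer using (+_)
open import Data.Integer.Solver renaming (module +-*-Solver to ℤ-Solver)
open import Data.Nat.Combinatorics using (_C_; nCk+nC[k+1]≡[n+1]C[k+1]; nC1≡n; nCk≡nC[n∸k])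
open import Data.Nat.Combinatorics.Specification using (k>n⇒nCk≡0)
open import Data.Nat.Solver renaming (module +-*-Solver to ℕ-Solver)

module FiniteSums {c ℓ} (R : CommutativeRing c ℓ) where
  open CommutativeRing R hiding (zero)
  open import Algebra.Properties.CommutativeSemigroup +-commutativeSemigroup using (interchange)
  open import Relation.Binary.Reasoning.Setoid setoid

  Σ≤ : ℕ → (ℕ → Carrier) → Carrier
  Σ≤ zero    f = f zero
  Σ≤ (suc n) f = Σ≤ n f + f (suc n)

  Σ≤-cong : ∀ n {f g} → (∀ i → i ≤ n → f i ≈ g i) → Σ≤ n f ≈ Σ≤ n g
  Σ≤-cong zero    f≈g = f≈g 0 z≤n
  Σ≤-cong (suc n) f≈g =
    +-cong (Σ≤-cong n (λ i i≤n → f≈g i (ℕ.m≤n⇒m≤1+n i≤n))) (f≈g (suc n) ℕ.≤-refl)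

  Σ≤-zero : ∀ n f → (∀ i → i ≤ n → f i ≈ 0#) → Σ≤ n f ≈ 0#
  Σ≤-zero zero    f f≈0 = f≈0 0 z≤n
  Σ≤-zero (suc n) f f≈0 = trans
    (+-cong (Σ≤-zero n f (λ i i≤n → f≈0 i (ℕ.m≤n⇒m≤1+n i≤n))) (f≈0 (suc n) ℕ.≤-refl))
    (+-identityˡ 0#)

  Σ≤-single : ∀ n k f → k ≤ n → (∀ i → i ≤ n → i ≢ k → f i ≈ 0#) → Σ≤ n f ≈ f k
  Σ≤-single zero .zero f z≤n _ = refl
  Σ≤-single (suc n) k f k≤1+n f≈0 with k ℕ.≟ suc n
  ... | yes ≡.refl = trans
    (+-congʳ (Σ≤-zero n f (λ i i≤n → f≈0 i (ℕ.m≤n⇒m≤1+n i≤n) (ℕ.<⇒≢ (s≤s i≤n)))))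
    (+-identityˡ _)
  ... | no k≢1+n = trans
    (+-cong (Σ≤-single n k f (ℕ.s≤s⁻¹ (ℕ.≤∧≢⇒< k≤1+n k≢1+n))
                       (λ i i≤n → f≈0 i (ℕ.m≤n⇒m≤1+n i≤n)))
            (f≈0 (suc n) ℕ.≤-refl (λ 1+n≡k → k≢1+n (≡.sym 1+n≡k))))
    (+-identityʳ _)

  Σ≤-+ : ∀ n f g → Σ≤ n (λ i → f i + g i) ≈ Σ≤ n f + Σ≤ n g
  Σ≤-+ zero    f g = refl
  Σ≤-+ (suc n) f g = trans (+-congʳ (Σ≤-+ n f g)) (interchange _ _ _ _)

  Σ≤-additive : ∀ (h : Carrier → Carrier) → (∀ x y → h (x + y) ≈ h x + h y) →
                ∀ n f → h (Σ≤ n f) ≈ Σ≤ n (λ i → h (f i))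
  Σ≤-additive h h-+ zero    f = refl
  Σ≤-additive h h-+ (suc n) f = trans (h-+ _ _) (+-congʳ (Σ≤-additive h h-+ n f))

  Σ≤-distribˡ : ∀ n a f → a * Σ≤ n f ≈ Σ≤ n (λ i → a * f i)
  Σ≤-distribˡ n a = Σ≤-additive (a *_) (distribˡ a) n

  Σ≤-suc : ∀ n f → Σ≤ (suc n) f ≈ f 0 + Σ≤ n (λ i → f (suc i))
  Σ≤-suc zero    f = refl
  Σ≤-suc (suc n) f = trans (+-congʳ (Σ≤-suc n f)) (+-assoc _ _ _)

  Σ≤-reverse : ∀ n f → Σ≤ n f ≈ Σ≤ n (λ i → f (n ∸ i))
  Σ≤-reverse zero    f = refl
  Σ≤-reverse (suc n) f = sym (begin
    Σ≤ (suc n) (λ i → f (suc n ∸ i))     ≈⟨ Σ≤-suc n _ ⟩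
    f (suc n) + Σ≤ n (λ i → f (n ∸ i))   ≈⟨ +-congˡ (Σ≤-reverse n f) ⟨
    f (suc n) + Σ≤ n f                   ≈⟨ +-comm _ _ ⟩
    Σ≤ (suc n) f                         ∎)

module _ {a b ℓa ℓb} {A : RawRing a ℓa} {B : RawRing b ℓb}
         {f : RawRing.Carrier A → RawRing.Carrier B} where
  private
    module A = RawRing A
    module B = RawRing B

  mkIsRingHomomorphism :
    (∀ {x y} → x A.≈ y → f x B.≈ f y) →
    (∀ x y → f (x A.+ y) B.≈ f x B.+ f y) →
    (∀ x y → f (x A.* y) B.≈ f x B.* f y) →
    (∀ x → f (A.- x) B.≈ B.- f x) →
    f A.0# B.≈ B.0# →
    f A.1# B.≈ B.1# →
    IsRingHomomorphism A B f
  mkIsRingHomomorphism f-cong f-+ f-* f-neg f-0 f-1 = record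
    { isSemiringHomomorphism = record
      { isNearSemiringHomomorphism = record
        { +-isMonoidHomomorphism = record
          { isMagmaHomomorphism = record
            { isRelHomomorphism = record { cong = f-cong }
            ; homo = f-+ }
          ; ε-homo = f-0 }
        ; *-homo = f-* }
      ; 1#-homo = f-1 }
    ; -‿homo = f-neg }

module _ {c ℓ} (R : CommutativeRing c ℓ) where
  open CommutativeRing R

  record Derivation : Set (c ⊔ ℓ) where
    field
      D       : Carrier → Carrier
      D-cong  : ∀ {x y} → x ≈ y → D x ≈ D y
      D-+     : ∀ x y → D (x + y) ≈ D x + D y
      leibniz : ∀ x y → D (x * y) ≈ D x * y + x * D y

  zeroDerivation : Derivation
  zeroDerivation = record
    { D = λ _ → 0#
    ; D-cong = λ _ → refl
    ; D-+ = λ _ _ → sym (+-identityˡ 0#)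
    ; leibniz = λ x y → sym (trans (+-cong (zeroˡ y) (zeroʳ x)) (+-identityˡ 0#))
    }

module DerivationProperties {c ℓ} {R : CommutativeRing c ℓ} (δ : Derivation R) where
  open CommutativeRing R hiding (zero)
  open Derivation δ
  open import Algebra.Properties.Semiring.Mult semiring using (_×_; ×-congʳ; ×-comm-*)
  open import Algebra.Properties.Semiring.Exp semiring using (_^_)
  open import Algebra.Properties.Group +-group using (identityˡ-unique)
  open import Relation.Binary.Reasoning.Setoid setoid

  D-1 : D 1# ≈ 0#
  D-1 = identityˡ-unique (D 1#) (D 1#) (begin
    D 1# + D 1#            ≈⟨ +-cong (*-identityʳ _) (*-identityˡ _) ⟨
    D 1# * 1# + 1# * D 1#  ≈⟨ leibniz 1# 1# ⟨
    D (1# * 1#)            ≈⟨ D-cong (*-identityˡ 1#) ⟩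
    D 1#                   ∎)

  D-^ : ∀ x k → D (x ^ suc k) ≈ suc k × (x ^ k * D x)
  D-^ x zero = begin
    D (x * 1#)               ≈⟨ leibniz x 1# ⟩
    D x * 1# + x * D 1#      ≈⟨ +-cong (trans (*-identityʳ _) (sym (*-identityˡ _))) (trans (*-congˡ D-1) (zeroʳ x)) ⟩
    1# * D x + 0#            ∎
  D-^ x (suc k) = begin
    D (x * x ^ suc k)                            ≈⟨ leibniz x _ ⟩
    D x * x ^ suc k + x * D (x ^ suc k)          ≈⟨ +-cong (*-comm _ _) (*-congˡ (D-^ x k)) ⟩
    x ^ suc k * D x + x * (suc k × (x ^ k * D x)) ≈⟨ +-congˡ (×-comm-* (suc k) x _) ⟩
    x ^ suc k * D x + suc k × (x * (x ^ k * D x)) ≈⟨ +-congˡ (×-congʳ (suc k) (*-assoc _ _ _)) ⟨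
    suc (suc k) × (x ^ suc k * D x)               ∎

module PowerSeries {c ℓ} (R : CommutativeRing c ℓ) where
  open CommutativeRing R hiding (zero)
  open FiniteSums R
  open import Algebra.Properties.Semiring.Mult semiring
    using (_×_; ×-congˡ; ×-congʳ; ×-homo-+; ×-assoc-*; ×-comm-*)
  open import Algebra.Properties.CommutativeMonoid.Mult +-commutativeMonoid using (×-distrib-+)
  open import Algebra.Properties.CommutativeSemigroup +-commutativeSemigroup using (interchange)
  open import Algebra.Properties.Semiring.Exp semiring using (_^_)
  open import Relation.Binary.Reasoning.Setoid setoid

  Series : Set c
  Series = ℕ → Carrier

  infix  4 _≈ₛ_
  infixl 6 _+ₛ_
  infixl 7 _*ₛ_ _·_

  _≈ₛ_ : Series → Series → Set ℓ
  f ≈ₛ g = ∀ n → f n ≈ g n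

  _+ₛ_ : Series → Series → Series
  (f +ₛ g) n = f n + g n

  -ₛ_ : Series → Series
  (-ₛ f) n = - f n

  0ₛ : Series
  0ₛ _ = 0#

  constₛ : Carrier → Series
  constₛ a zero    = a
  constₛ a (suc _) = 0#

  1ₛ : Series
  1ₛ = constₛ 1#

  _*ₛ_ : Series → Series → Series
  (f *ₛ g) n = Σ≤ n (λ i → f i * g (n ∸ i))

  _·_ : Carrier → Series → Series
  (a · f) n = a * f n

  shift : Series → Series
  shift f n = f (suc n)

  *ₛ-cong : ∀ {f f′ g g′} → f ≈ₛ f′ → g ≈ₛ g′ → f *ₛ g ≈ₛ f′ *ₛ g′
  *ₛ-cong f≈f′ g≈g′ n = Σ≤-cong n (λ i _ → *-cong (f≈f′ i) (g≈g′ (n ∸ i)))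

  *ₛ-comm : ∀ f g → f *ₛ g ≈ₛ g *ₛ f
  *ₛ-comm f g n = trans (Σ≤-reverse n _) (Σ≤-cong n (λ i i≤n →
    trans (*-congˡ (reflexive (≡.cong g (ℕ.m∸[m∸n]≡n i≤n)))) (*-comm _ _)))

  constₛ-*ₛ : ∀ a f → constₛ a *ₛ f ≈ₛ a · f
  constₛ-*ₛ a f n = Σ≤-single n 0 _ z≤n λ where
    zero    _ 0≢0 → contradiction ≡.refl 0≢0
    (suc i) _ _   → zeroˡ _

  *ₛ-identityˡ : ∀ f → 1ₛ *ₛ f ≈ₛ f
  *ₛ-identityˡ f n = trans (constₛ-*ₛ 1# f n) (*-identityˡ _)

  *ₛ-identityʳ : ∀ f → f *ₛ 1ₛ ≈ₛ f
  *ₛ-identityʳ f n = trans (*ₛ-comm f 1ₛ n) (*ₛ-identityˡ f n)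

  *ₛ-distribˡ : ∀ f g h → f *ₛ (g +ₛ h) ≈ₛ f *ₛ g +ₛ f *ₛ h
  *ₛ-distribˡ f g h n = trans (Σ≤-cong n (λ i _ → distribˡ _ _ _)) (Σ≤-+ n _ _)

  *ₛ-distribʳ : ∀ f g h → (g +ₛ h) *ₛ f ≈ₛ g *ₛ f +ₛ h *ₛ f
  *ₛ-distribʳ f g h n = trans (Σ≤-cong n (λ i _ → distribʳ _ _ _)) (Σ≤-+ n _ _)

  ·-*ₛ : ∀ a f g → (a · f) *ₛ g ≈ₛ a · (f *ₛ g)
  ·-*ₛ a f g n = trans (Σ≤-cong n (λ i _ → *-assoc _ _ _)) (sym (Σ≤-distribˡ n a _))

  shift-*ₛ : ∀ f g → shift (f *ₛ g) ≈ₛ f 0 · shift g +ₛ shift f *ₛ g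
  shift-*ₛ f g n = Σ≤-suc n _

  *ₛ-assoc : ∀ f g h → (f *ₛ g) *ₛ h ≈ₛ f *ₛ (g *ₛ h)
  *ₛ-assoc f g h zero    = *-assoc _ _ _
  *ₛ-assoc f g h (suc n) = begin
    ((f *ₛ g) *ₛ h) (suc n)
      ≈⟨ Σ≤-suc n _ ⟩
    f 0 * g 0 * h (suc n) + (shift (f *ₛ g) *ₛ h) n
      ≈⟨ +-congˡ (trans (*ₛ-cong {g = h} {g′ = h} (shift-*ₛ f g) (λ _ → refl) n) (*ₛ-distribʳ h _ _ n)) ⟩
    f 0 * g 0 * h (suc n) + (((f 0 · shift g) *ₛ h) n + ((shift f *ₛ g) *ₛ h) n)
      ≈⟨ +-congˡ (+-cong (·-*ₛ (f 0) (shift g) h n) (*ₛ-assoc (shift f) g h n)) ⟩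
    f 0 * g 0 * h (suc n) + (f 0 * (shift g *ₛ h) n + (shift f *ₛ (g *ₛ h)) n)
      ≈⟨ +-assoc _ _ _ ⟨
    f 0 * g 0 * h (suc n) + f 0 * (shift g *ₛ h) n + (shift f *ₛ (g *ₛ h)) n
      ≈⟨ +-congʳ (trans (+-congʳ (*-assoc _ _ _)) (sym (distribˡ _ _ _))) ⟩
    f 0 * (g 0 * h (suc n) + (shift g *ₛ h) n) + (shift f *ₛ (g *ₛ h)) n
      ≈⟨ +-congʳ (*-congˡ (Σ≤-suc n _)) ⟨
    f 0 * (g *ₛ h) (suc n) + (shift f *ₛ (g *ₛ h)) n
      ≈⟨ Σ≤-suc n _ ⟨
    (f *ₛ (g *ₛ h)) (suc n) ∎

  seriesRing : CommutativeRing c ℓ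
  seriesRing = record
    { Carrier = Series ; _≈_ = _≈ₛ_ ; _+_ = _+ₛ_ ; _*_ = _*ₛ_ ; -_ = -ₛ_ ; 0# = 0ₛ ; 1# = 1ₛ
    ; isCommutativeRing = record
      { isRing = record
        { +-isAbelianGroup = record
          { isGroup = record
            { isMonoid = record
              { isSemigroup = record
                { isMagma = record
                  { isEquivalence = record
                    { refl = λ _ → refl ; sym = λ p n → sym (p n) ; trans = λ p q n → trans (p n) (q n) }
                  ; ∙-cong = λ p q n → +-cong (p n) (q n) }
                ; assoc = λ f g h n → +-assoc (f n) (g n) (h n) }
              ; identity = (λ f n → +-identityˡ (f n)) , (λ f n → +-identityʳ (f n)) }
            ; inverse = (λ f n → -‿inverseˡ (f n)) , (λ f n → -‿inverseʳ (f n))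
            ; ⁻¹-cong = λ p n → -‿cong (p n) }
          ; comm = λ f g n → +-comm (f n) (g n) }
        ; *-cong = *ₛ-cong
        ; *-assoc = *ₛ-assoc
        ; *-identity = *ₛ-identityˡ , *ₛ-identityʳ
        ; distrib = *ₛ-distribˡ , *ₛ-distribʳ }
      ; *-comm = *ₛ-comm } }

  constₛ-isRingHomomorphism : IsRingHomomorphism rawRing (CommutativeRing.rawRing seriesRing) constₛ
  constₛ-isRingHomomorphism = mkIsRingHomomorphism
    (λ { x≈y zero → x≈y ; _ (suc _) → refl })
    (λ { _ _ zero → refl ; _ _ (suc _) → sym (+-identityˡ 0#) })
    (λ x y n → sym (trans (constₛ-*ₛ x (constₛ y) n) (x*constₛ y n)))
    (λ { _ zero → refl ; _ (suc _) → sym -0#≈0# })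
    (λ { zero → refl ; (suc _) → refl })
    (λ _ → refl)
    where
    open import Algebra.Properties.Ring ring using (-0#≈0#)
    x*constₛ : ∀ {x} y n → x * constₛ y n ≈ constₛ (x * y) n
    x*constₛ y zero    = refl
    x*constₛ y (suc n) = zeroʳ _

  open import Algebra.Properties.Semiring.Mult (CommutativeRing.semiring seriesRing)
    using () renaming (_×_ to _×ₛ_)
  open import Algebra.Properties.Semiring.Exp (CommutativeRing.semiring seriesRing)
    using () renaming (_^_ to _^ₛ_)

  ×ₛ-coeff : ∀ k f n → (k ×ₛ f) n ≈ k × f n
  ×ₛ-coeff zero    f n = refl
  ×ₛ-coeff (suc k) f n = +-congˡ (×ₛ-coeff k f n)

  X : Series
  X (suc zero) = 1#
  X _          = 0#

  X-*ₛ-suc : ∀ f n → (X *ₛ f) (suc n) ≈ f n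
  X-*ₛ-suc f n = trans (Σ≤-single (suc n) 1 _ (s≤s z≤n) off) (*-identityˡ (f n))
    where
    off : ∀ i → i ≤ suc n → i ≢ 1 → X i * f (suc n ∸ i) ≈ 0#
    off zero          _ _   = zeroˡ _
    off (suc zero)    _ 1≢1 = contradiction ≡.refl 1≢1
    off (suc (suc i)) _ _   = zeroˡ _

  ·X-*ₛ-zero : ∀ a f → ((a · X) *ₛ f) 0 ≈ 0#
  ·X-*ₛ-zero a f = trans (·-*ₛ a X f 0) (trans (*-congˡ (zeroˡ (f 0))) (zeroʳ a))

  ·X-*ₛ-suc : ∀ a f n → ((a · X) *ₛ f) (suc n) ≈ a * f n
  ·X-*ₛ-suc a f n = trans (·-*ₛ a X f (suc n)) (*-congˡ (X-*ₛ-suc f n))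

  ·X-^-diag : ∀ a k → ((a · X) ^ₛ k) k ≈ a ^ k
  ·X-^-diag a zero    = refl
  ·X-^-diag a (suc k) = trans (·X-*ₛ-suc a ((a · X) ^ₛ k) k) (*-congˡ (·X-^-diag a k))

  ·X-^-off : ∀ a k n → n ≢ k → ((a · X) ^ₛ k) n ≈ 0#
  ·X-^-off a zero    zero    0≢0 = contradiction ≡.refl 0≢0
  ·X-^-off a zero    (suc n) _   = refl
  ·X-^-off a (suc k) zero    _   = ·X-*ₛ-zero a ((a · X) ^ₛ k)
  ·X-^-off a (suc k) (suc n) n≢k = trans (·X-*ₛ-suc a ((a · X) ^ₛ k) n)
    (trans (*-congˡ (·X-^-off a k n (λ n≡k → n≢k (≡.cong suc n≡k)))) (zeroʳ a))

  eulerDerivation : Derivation R → Derivation seriesRing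
  eulerDerivation δ = record
    { D = E
    ; D-cong = λ f≈g n → +-cong (×-congʳ n (f≈g n)) (D-cong (f≈g n))
    ; D-+ = λ f g n → trans (+-cong (×-distrib-+ _ _ n) (D-+ _ _)) (interchange _ _ _ _)
    ; leibniz = E-leibniz
    }
    where
    open Derivation δ

    E : Series → Series
    E f n = n × f n + D (f n)

    E-term : ∀ i j a b → (i ℕ.+ j) × (a * b) + (D a * b + a * D b) ≈ (i × a + D a) * b + a * (j × b + D b)
    E-term i j a b = begin
      (i ℕ.+ j) × (a * b) + (D a * b + a * D b)        ≈⟨ +-congʳ (×-homo-+ _ i j) ⟩
      (i × (a * b) + j × (a * b)) + (D a * b + a * D b)  ≈⟨ +-congʳ (+-cong (×-assoc-* i a b) (×-comm-* j a b)) ⟨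
      ((i × a) * b + a * (j × b)) + (D a * b + a * D b) ≈⟨ interchange _ _ _ _ ⟩
      ((i × a) * b + D a * b) + (a * (j × b) + a * D b) ≈⟨ +-cong (distribʳ _ _ _) (distribˡ _ _ _) ⟨
      (i × a + D a) * b + a * (j × b + D b)            ∎

    E-leibniz : ∀ f g → E (f *ₛ g) ≈ₛ E f *ₛ g +ₛ f *ₛ E g
    E-leibniz f g n = begin
      n × (f *ₛ g) n + D ((f *ₛ g) n)
        ≈⟨ +-cong (Σ≤-additive (n ×_) (λ x y → ×-distrib-+ x y n) n _) (Σ≤-additive D D-+ n _) ⟩
      Σ≤ n (λ i → n × (f i * g (n ∸ i))) + Σ≤ n (λ i → D (f i * g (n ∸ i)))
        ≈⟨ Σ≤-+ n _ _ ⟨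
      Σ≤ n (λ i → n × (f i * g (n ∸ i)) + D (f i * g (n ∸ i)))
        ≈⟨ Σ≤-cong n (λ i i≤n → trans (+-cong (×-congˡ (≡.sym (ℕ.m+[n∸m]≡n i≤n))) (leibniz _ _))
                                      (E-term i (n ∸ i) (f i) (g (n ∸ i)))) ⟩
      Σ≤ n (λ i → E f i * g (n ∸ i) + f i * E g (n ∸ i))
        ≈⟨ Σ≤-+ n _ _ ⟩
      (E f *ₛ g +ₛ f *ₛ E g) n ∎

module _ {c ℓ} (R : CommutativeRing c ℓ) where
  open CommutativeRing R hiding (zero)
  open import Algebra.Properties.Semiring.Exp semiring using (_^_)
  open import Relation.Binary.Reasoning.Setoid setoid

  geometricSum : Carrier → ℕ → Carrier
  geometricSum x zero    = 0#
  geometricSum x (suc n) = geometricSum x n + x ^ n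

  geometricSum-telescope : ∀ x n → geometricSum x n * (1# - x) + x ^ n ≈ 1#
  geometricSum-telescope x zero = trans (+-congʳ (zeroˡ _)) (+-identityˡ 1#)
  geometricSum-telescope x (suc n) = begin
    (g + x ^ n) * (1# - x) + x * x ^ n           ≈⟨ +-cong (distribʳ _ _ _) (*-comm _ _) ⟩
    (g * (1# - x) + x ^ n * (1# - x)) + x ^ n * x ≈⟨ +-assoc _ _ _ ⟩
    g * (1# - x) + (x ^ n * (1# - x) + x ^ n * x) ≈⟨ +-congˡ (distribˡ _ _ _) ⟨
    g * (1# - x) + x ^ n * ((1# - x) + x)        ≈⟨ +-congˡ (*-congˡ 1-x+x≈1) ⟩
    g * (1# - x) + x ^ n * 1#                    ≈⟨ +-congˡ (*-identityʳ _) ⟩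
    g * (1# - x) + x ^ n                         ≈⟨ geometricSum-telescope x n ⟩
    1#                                           ∎
    where
    g = geometricSum x n
    1-x+x≈1 : (1# - x) + x ≈ 1#
    1-x+x≈1 = trans (+-assoc _ _ _) (trans (+-congˡ (-‿inverseˡ x)) (+-identityʳ 1#))

module _ {c₁ ℓ₁ c₂ ℓ₂} (R₁ : CommutativeRing c₁ ℓ₁) (R₂ : CommutativeRing c₂ ℓ₂)
         {φ : CommutativeRing.Carrier R₁ → CommutativeRing.Carrier R₂}
         (φ-hom : IsRingHomomorphism (CommutativeRing.rawRing R₁) (CommutativeRing.rawRing R₂) φ) where
  private
    module R₁ = CommutativeRing R₁
    module R₂ = CommutativeRing R₂
    module S₁ = PowerSeries R₁
    module S₂ = PowerSeries R₂
    module Σ₁ = FiniteSums R₁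
    module Σ₂ = FiniteSums R₂
  open IsRingHomomorphism φ-hom
  open import Algebra.Properties.Semiring.Exp R₁.semiring using () renaming (_^_ to _^₁_)
  open import Algebra.Properties.Semiring.Exp R₂.semiring using () renaming (_^_ to _^₂_)

  ^-homo : ∀ x k → φ (x ^₁ k) R₂.≈ φ x ^₂ k
  ^-homo x zero    = 1#-homo
  ^-homo x (suc k) = R₂.trans (*-homo _ _) (R₂.*-congˡ (^-homo x k))

  Σ≤-homo : ∀ n f → φ (Σ₁.Σ≤ n f) R₂.≈ Σ₂.Σ≤ n (λ i → φ (f i))
  Σ≤-homo zero    f = R₂.refl
  Σ≤-homo (suc n) f = R₂.trans (+-homo _ _) (R₂.+-congʳ (Σ≤-homo n f))

  mapₛ : S₁.Series → S₂.Series
  mapₛ f n = φ (f n)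

  mapₛ-isRingHomomorphism :
    IsRingHomomorphism (CommutativeRing.rawRing S₁.seriesRing) (CommutativeRing.rawRing S₂.seriesRing) mapₛ
  mapₛ-isRingHomomorphism = mkIsRingHomomorphism
    (λ f≈g n → ⟦⟧-cong (f≈g n))
    (λ _ _ _ → +-homo _ _)
    (λ f g n → R₂.trans (Σ≤-homo n _) (Σ₂.Σ≤-cong n (λ _ _ → *-homo _ _)))
    (λ _ _ → -‿homo _)
    (λ _ → 0#-homo)
    (λ { zero → 1#-homo ; (suc _) → 0#-homo })

-- A bivariate series is a series in p whose coefficients are series in q, so F r s is the
-- coefficient of pʳqˢ; embedP f = f(p) and embedQ f = f(q).
module Bivariate {c ℓ} (R : CommutativeRing c ℓ) where
  open CommutativeRing R hiding (zero)
  open FiniteSums R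
  open import Algebra.Properties.Semiring.Mult semiring using (_×_; ×-congˡ; ×-homo-+)
  module S₁ = PowerSeries R
  module S₂ = PowerSeries S₁.seriesRing
  open S₂ using (_*ₛ_) renaming (_≈ₛ_ to _≈₂_)
  open import Algebra.Properties.Semiring.Exp (CommutativeRing.semiring S₂.seriesRing) using (_^_)

  Series₂ : Set c
  Series₂ = S₂.Series

  embedP embedQ : S₁.Series → Series₂
  embedP = mapₛ R S₁.seriesRing S₁.constₛ-isRingHomomorphism
  embedQ = S₂.constₛ

  embedP-isRingHomomorphism :
    IsRingHomomorphism (CommutativeRing.rawRing S₁.seriesRing) (CommutativeRing.rawRing S₂.seriesRing) embedP
  embedP-isRingHomomorphism = mapₛ-isRingHomomorphism R S₁.seriesRing S₁.constₛ-isRingHomomorphism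

  const₂ : Carrier → Series₂
  const₂ a = S₂.constₛ (S₁.constₛ a)

  embedP-constₛ : ∀ a → embedP (S₁.constₛ a) ≈₂ const₂ a
  embedP-constₛ a zero    zero    = refl
  embedP-constₛ a zero    (suc s) = refl
  embedP-constₛ a (suc r) zero    = refl
  embedP-constₛ a (suc r) (suc s) = refl

  euler₁ : Derivation S₁.seriesRing
  euler₁ = S₁.eulerDerivation (zeroDerivation R)

  euler₂ : Derivation S₂.seriesRing
  euler₂ = S₂.eulerDerivation euler₁

  E₁ : S₁.Series → S₁.Series
  E₁ = Derivation.D euler₁

  E₂ : Series₂ → Series₂
  E₂ = Derivation.D euler₂

  E₁-coeff : ∀ f n → E₁ f n ≈ n × f n
  E₁-coeff f n = +-identityʳ _

  E₂-coeff : ∀ F r s → E₂ F r s ≈ (r ℕ.+ s) × F r s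
  E₂-coeff F r s = trans (+-cong (S₁.×ₛ-coeff r (F r) s) (E₁-coeff (F r) s)) (sym (×-homo-+ _ r s))

  ×-zeroʳ : ∀ n → n × 0# ≈ 0#
  ×-zeroʳ zero    = refl
  ×-zeroʳ (suc n) = trans (+-congˡ (×-zeroʳ n)) (+-identityˡ 0#)

  E₂-embedP : ∀ f → E₂ (embedP f) ≈₂ embedP (E₁ f)
  E₂-embedP f r zero    = trans (E₂-coeff (embedP f) r 0)
    (trans (×-congˡ (ℕ.+-identityʳ r)) (sym (E₁-coeff f r)))
  E₂-embedP f r (suc s) = trans (E₂-coeff (embedP f) r (suc s)) (×-zeroʳ (r ℕ.+ suc s))

  E₂-embedQ : ∀ f → E₂ (embedQ f) ≈₂ embedQ (E₁ f)
  E₂-embedQ f zero    s = trans (E₂-coeff (embedQ f) 0 s) (sym (E₁-coeff f s))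
  E₂-embedQ f (suc r) s = trans (E₂-coeff (embedQ f) (suc r) s) (×-zeroʳ (suc r ℕ.+ s))

  *₂-coeff : ∀ F G r s → (F *ₛ G) r s ≈ Σ≤ r (λ i → Σ≤ s (λ j → F i j * G (r ∸ i) (s ∸ j)))
  *₂-coeff F G r s = Σ≤₁-coeff r (λ i → F i S₁.*ₛ G (r ∸ i))
    where
    Σ≤₁-coeff : ∀ n (fs : ℕ → S₁.Series) → FiniteSums.Σ≤ S₁.seriesRing n fs s ≈ Σ≤ n (λ i → fs i s)
    Σ≤₁-coeff zero    fs = refl
    Σ≤₁-coeff (suc n) fs = +-congʳ (Σ≤₁-coeff n fs)

  HasOrder : ℕ → Series₂ → Set ℓ
  HasOrder k F = ∀ r s → r ℕ.+ s < k → F r s ≈ 0#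

  hasOrder-* : ∀ {a b F G} → HasOrder a F → HasOrder b G → HasOrder (a ℕ.+ b) (F *ₛ G)
  hasOrder-* {a} {b} {F} {G} F≈0 G≈0 r s r+s<a+b = trans (*₂-coeff F G r s)
    (Σ≤-zero r _ λ i i≤r → Σ≤-zero s _ λ j j≤s → term i j i≤r j≤s)
    where
    open import Algebra.Properties.CommutativeSemigroup ℕ.+-commutativeSemigroup using (interchange)
    term : ∀ i j → i ≤ r → j ≤ s → F i j * G (r ∸ i) (s ∸ j) ≈ 0#
    term i j i≤r j≤s with i ℕ.+ j ℕ.<? a | (r ∸ i) ℕ.+ (s ∸ j) ℕ.<? b
    ... | yes i+j<a | _       = trans (*-congʳ (F≈0 i j i+j<a)) (zeroˡ _)
    ... | no _      | yes t<b = trans (*-congˡ (G≈0 _ _ t<b)) (zeroʳ _)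
    ... | no i+j≮a  | no t≮b  = contradiction
      (≡.subst (a ℕ.+ b ≤_) split (ℕ.+-mono-≤ (ℕ.≮⇒≥ i+j≮a) (ℕ.≮⇒≥ t≮b))) (ℕ.<⇒≱ r+s<a+b)
      where
      split : (i ℕ.+ j) ℕ.+ ((r ∸ i) ℕ.+ (s ∸ j)) ≡ r ℕ.+ s
      split = ≡.trans (interchange i j (r ∸ i) (s ∸ j))
                      (≡.cong₂ ℕ._+_ (ℕ.m+[n∸m]≡n i≤r) (ℕ.m+[n∸m]≡n j≤s))

  hasOrder-^ : ∀ {F} → HasOrder 1 F → ∀ k → HasOrder k (F ^ k)
  hasOrder-^ F≈0 zero    r s ()
  hasOrder-^ F≈0 (suc k) = hasOrder-* F≈0 (hasOrder-^ F≈0 k)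

-- Rational constants are normalised in ℚ, where equality is decidable, so identities with
-- rational coefficients can be solved in any commutative ring receiving ℚ.
module ℚ-AlgebraSolver {c ℓ} (A : CommutativeRing c ℓ) {ι : ℚ → CommutativeRing.Carrier A}
       (ι-hom : IsRingHomomorphism ℚ.+-*-rawRing (CommutativeRing.rawRing A) ι) where
  open CommutativeRing A using (refl)
  open IsRingHomomorphism ι-hom

  private
    ι-morphism : ℚ.+-*-rawRing -Raw-AlmostCommutative⟶ fromCommutativeRing A
    ι-morphism = record
      { ⟦_⟧ = ι ; +-homo = +-homo ; *-homo = *-homo ; -‿homo = -‿homo ; 0-homo = 0#-homo ; 1-homo = 1#-homo }

    coeff? : WeaklyDecidable (Induced-equivalence ι-morphism)
    coeff? p q with p ℚ.≟ q
    ... | yes ≡.refl = just refl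
    ... | no  _      = nothing

  open import Algebra.Solver.Ring ℚ.+-*-rawRing (fromCommutativeRing A) ι-morphism coeff? public

[1+k]*[1+n]C[1+k]≡[1+n]*nCk : ∀ n k → suc k ℕ.* (suc n C suc k) ≡ suc n ℕ.* (n C k)
[1+k]*[1+n]C[1+k]≡[1+n]*nCk zero    zero    = ≡.refl
[1+k]*[1+n]C[1+k]≡[1+n]*nCk zero    (suc k) = begin
  suc (suc k) ℕ.* (1 C suc (suc k))   ≡⟨ ≡.cong (suc (suc k) ℕ.*_) (k>n⇒nCk≡0 {1} {suc (suc k)} (s≤s (s≤s z≤n))) ⟩
  suc (suc k) ℕ.* 0                   ≡⟨ ℕ.*-zeroʳ (suc (suc k)) ⟩
  0                                   ≡⟨ k>n⇒nCk≡0 {0} {suc k} (s≤s z≤n) ⟨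
  0 C suc k                           ≡⟨ ℕ.*-identityˡ (0 C suc k) ⟨
  1 ℕ.* (0 C suc k)                   ∎
  where open ≡.≡-Reasoning
[1+k]*[1+n]C[1+k]≡[1+n]*nCk (suc n) zero    =
  ≡.trans (ℕ.*-identityˡ _) (≡.trans (nC1≡n (suc (suc n))) (≡.sym (ℕ.*-identityʳ _)))
[1+k]*[1+n]C[1+k]≡[1+n]*nCk (suc n) (suc k) = begin
  2+k ℕ.* (2+n C 2+k)                                   ≡⟨ ≡.cong (2+k ℕ.*_) (nCk+nC[k+1]≡[n+1]C[k+1] (suc n) (suc k)) ⟨
  2+k ℕ.* (1+n C 1+k ℕ.+ 1+n C 2+k)                     ≡⟨ ℕ.*-distribˡ-+ 2+k (1+n C 1+k) (1+n C 2+k) ⟩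
  (1+n C 1+k ℕ.+ 1+k ℕ.* (1+n C 1+k)) ℕ.+ 2+k ℕ.* (1+n C 2+k)
    ≡⟨ ≡.cong₂ (λ u v → (1+n C 1+k ℕ.+ u) ℕ.+ v)
               ([1+k]*[1+n]C[1+k]≡[1+n]*nCk n k) ([1+k]*[1+n]C[1+k]≡[1+n]*nCk n (suc k)) ⟩
  (1+n C 1+k ℕ.+ 1+n ℕ.* (n C k)) ℕ.+ 1+n ℕ.* (n C 1+k) ≡⟨ ℕ.+-assoc (1+n C 1+k) _ _ ⟩
  1+n C 1+k ℕ.+ (1+n ℕ.* (n C k) ℕ.+ 1+n ℕ.* (n C 1+k)) ≡⟨ ≡.cong (1+n C 1+k ℕ.+_) (ℕ.*-distribˡ-+ 1+n (n C k) (n C 1+k)) ⟨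
  1+n C 1+k ℕ.+ 1+n ℕ.* (n C k ℕ.+ n C 1+k)             ≡⟨ ≡.cong (λ u → 1+n C 1+k ℕ.+ 1+n ℕ.* u) (nCk+nC[k+1]≡[n+1]C[k+1] n k) ⟩
  2+n ℕ.* (1+n C 1+k)                                   ∎
  where
  open ≡.≡-Reasoning
  1+n 2+n 1+k 2+k : ℕ
  1+n = suc n
  2+n = suc 1+n
  1+k = suc k
  2+k = suc 1+k

central : ℕ → ℕ
central k = (2 ℕ.* k) C k

central-rec : ∀ k → suc k ℕ.* central (suc k) ≡ (4 ℕ.* k ℕ.+ 2) ℕ.* central k
central-rec k = begin
  suc k ℕ.* central (suc k)         ≡⟨ ≡.cong (λ m → suc k ℕ.* (m C suc k)) 2+2k≡2[1+k] ⟨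
  suc k ℕ.* (2+2k C suc k)          ≡⟨ [1+k]*[1+n]C[1+k]≡[1+n]*nCk 1+2k k ⟩
  2+2k ℕ.* (1+2k C k)               ≡⟨ ≡.cong₂ ℕ._*_ 2+2k≡2[1+k] 1+2kCk≡1+2kC[1+k] ⟩
  (2 ℕ.* suc k) ℕ.* (1+2k C suc k)  ≡⟨ ℕ.*-assoc 2 (suc k) _ ⟩
  2 ℕ.* (suc k ℕ.* (1+2k C suc k))  ≡⟨ ≡.cong (2 ℕ.*_) ([1+k]*[1+n]C[1+k]≡[1+n]*nCk (2 ℕ.* k) k) ⟩
  2 ℕ.* (1+2k ℕ.* central k)        ≡⟨ ℕ.*-assoc 2 1+2k _ ⟨
  (2 ℕ.* 1+2k) ℕ.* central k        ≡⟨ ≡.cong (ℕ._* central k)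
                                        (solve 1 (λ k → con 2 :* (con 1 :+ con 2 :* k) := con 4 :* k :+ con 2) ≡.refl k) ⟩
  (4 ℕ.* k ℕ.+ 2) ℕ.* central k     ∎
  where
  open ≡.≡-Reasoning
  open ℕ-Solver
  1+2k 2+2k : ℕ
  1+2k = suc (2 ℕ.* k)
  2+2k = suc 1+2k
  2+2k≡2[1+k] : 2+2k ≡ 2 ℕ.* suc k
  2+2k≡2[1+k] = solve 1 (λ k → con 2 :+ con 2 :* k := con 2 :* (con 1 :+ k)) ≡.refl k
  1+2kCk≡1+2kC[1+k] : 1+2k C k ≡ 1+2k C suc k
  1+2kCk≡1+2kC[1+k] = ≡.trans (nCk≡nC[n∸k] (ℕ.m≤n⇒m≤1+n (ℕ.m≤m+n k (k ℕ.+ 0))))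
    (≡.cong (1+2k C_) (≡.trans (ℕ.+-∸-assoc 1 (ℕ.m≤m+n k (k ℕ.+ 0)))
                               (≡.cong suc (≡.trans (ℕ.m+n∸m≡n k (k ℕ.+ 0)) (ℕ.+-identityʳ k)))))

ℚ-ring : CommutativeRing _ _
ℚ-ring = ℚ.+-*-commutativeRing

open Bivariate ℚ-ring

module S₁-Solver = ℚ-AlgebraSolver S₁.seriesRing S₁.constₛ-isRingHomomorphism
module S₂-Solver = ℚ-AlgebraSolver S₂.seriesRing
  (Composition.isRingHomomorphism (CommutativeRing.trans S₂.seriesRing)
     S₁.constₛ-isRingHomomorphism S₂.constₛ-isRingHomomorphism)

open import Defs
open import Data.Rational.Solver renaming (module +-*-Solver to ℚ-Solver)
open import Algebra.Properties.Semiring.Mult (CommutativeRing.semiring ℚ-ring)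
  using (×-homo-+; ×1-homo-*; ×-assoc-*) renaming (_×_ to _×ℚ_)


ℕ→ℚ-suc : ∀ n → ℕ→ℚ (suc n) ≡ 1ℚ ℚ.+ ℕ→ℚ n
ℕ→ℚ-suc n = ℚ.toℚᵘ-injective (begin
  ℚ.toℚᵘ (ℕ→ℚ (suc n))                  ≈⟨ ℚ.toℚᵘ-fromℚᵘ (mkℚᵘ (+ suc n) 0) ⟩
  mkℚᵘ (+ suc n) 0                       ≈⟨ *≡* (solve 1 (λ m → (con (+ 1) :+ m) :* (con (+ 1) :* con (+ 1))
                                                            := (con (+ 1) :* con (+ 1) :+ m :* con (+ 1)) :* con (+ 1))
                                                      ≡.refl (+ n)) ⟩
  mkℚᵘ (+ 1) 0 ℚᵘ.+ mkℚᵘ (+ n) 0         ≈⟨ ℚᵘ.+-cong (ℚ.toℚᵘ-fromℚᵘ (mkℚᵘ (+ 1) 0)) (ℚ.toℚᵘ-fromℚᵘ (mkℚᵘ (+ n) 0)) ⟨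
  ℚ.toℚᵘ 1ℚ ℚᵘ.+ ℚ.toℚᵘ (ℕ→ℚ n)          ≈⟨ ℚ.toℚᵘ-homo-+ 1ℚ (ℕ→ℚ n) ⟨
  ℚ.toℚᵘ (1ℚ ℚ.+ ℕ→ℚ n)                  ∎)
  where
  open ℚᵘ.≃-Reasoning
  open ℤ-Solver

inv-*-ℕ→ℚ : ∀ n .{{_ : ℕ.NonZero n}} → inv n ℚ.* ℕ→ℚ n ≡ 1ℚ
inv-*-ℕ→ℚ (suc n) = ℚ.toℚᵘ-injective (begin
  ℚ.toℚᵘ (inv (suc n) ℚ.* ℕ→ℚ (suc n))                    ≈⟨ ℚ.toℚᵘ-homo-* (inv (suc n)) (ℕ→ℚ (suc n)) ⟩
  ℚ.toℚᵘ (inv (suc n)) ℚᵘ.* ℚ.toℚᵘ (ℕ→ℚ (suc n))          ≈⟨ ℚᵘ.*-cong (ℚ.toℚᵘ-fromℚᵘ (mkℚᵘ (+ 1) n))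
                                                                        (ℚ.toℚᵘ-fromℚᵘ (mkℚᵘ (+ suc n) 0)) ⟩
  mkℚᵘ (+ 1) n ℚᵘ.* mkℚᵘ (+ suc n) 0                      ≈⟨ *≡* (solve 1 (λ m → con (+ 1) :* m :* con (+ 1)
                                                                              := con (+ 1) :* (m :* con (+ 1)))
                                                                        ≡.refl (+ suc n)) ⟩
  ℚ.toℚᵘ 1ℚ                                               ∎)
  where
  open ℚᵘ.≃-Reasoning
  open ℤ-Solver

inv-*-ℕ→ℚ-* : ∀ n .{{_ : ℕ.NonZero n}} q → inv n ℚ.* (ℕ→ℚ n ℚ.* q) ≡ q
inv-*-ℕ→ℚ-* n q = ≡.trans (≡.sym (ℚ.*-assoc (inv n) _ q))
  (≡.trans (≡.cong (ℚ._* q) (inv-*-ℕ→ℚ n)) (ℚ.*-identityˡ q))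

ℕ→ℚ-cancelˡ : ∀ n {p q} → ℕ→ℚ (suc n) ℚ.* p ≡ ℕ→ℚ (suc n) ℚ.* q → p ≡ q
ℕ→ℚ-cancelˡ n {p} {q} eq =
  ≡.trans (≡.sym (inv-*-ℕ→ℚ-* (suc n) p)) (≡.trans (≡.cong (inv (suc n) ℚ.*_) eq) (inv-*-ℕ→ℚ-* (suc n) q))

ℕ→ℚ≡×1ℚ : ∀ n → ℕ→ℚ n ≡ n ×ℚ 1ℚ
ℕ→ℚ≡×1ℚ zero    = ≡.refl
ℕ→ℚ≡×1ℚ (suc n) = ≡.trans (ℕ→ℚ-suc n) (≡.cong (1ℚ ℚ.+_) (ℕ→ℚ≡×1ℚ n))

×≡ℕ→ℚ* : ∀ n q → n ×ℚ q ≡ ℕ→ℚ n ℚ.* q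
×≡ℕ→ℚ* n q = begin
  n ×ℚ q            ≡⟨ ≡.cong (n ×ℚ_) (ℚ.*-identityˡ q) ⟨
  n ×ℚ (1ℚ ℚ.* q)   ≡⟨ ×-assoc-* n 1ℚ q ⟨
  (n ×ℚ 1ℚ) ℚ.* q   ≡⟨ ≡.cong (ℚ._* q) (ℕ→ℚ≡×1ℚ n) ⟨
  ℕ→ℚ n ℚ.* q      ∎
  where open ≡.≡-Reasoning

ℕ→ℚ-+ : ∀ m n → ℕ→ℚ (m ℕ.+ n) ≡ ℕ→ℚ m ℚ.+ ℕ→ℚ n
ℕ→ℚ-+ m n = ≡.trans (ℕ→ℚ≡×1ℚ (m ℕ.+ n))
  (≡.trans (×-homo-+ 1ℚ m n) (≡.sym (≡.cong₂ ℚ._+_ (ℕ→ℚ≡×1ℚ m) (ℕ→ℚ≡×1ℚ n))))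

ℕ→ℚ-* : ∀ m n → ℕ→ℚ (m ℕ.* n) ≡ ℕ→ℚ m ℚ.* ℕ→ℚ n
ℕ→ℚ-* m n = ≡.trans (ℕ→ℚ≡×1ℚ (m ℕ.* n))
  (≡.trans (×1-homo-* m n) (≡.sym (≡.cong₂ ℚ._*_ (ℕ→ℚ≡×1ℚ m) (ℕ→ℚ≡×1ℚ n))))

open FiniteSums ℚ-ring
open S₁ using (constₛ; X; _·_)
open CommutativeRing S₁.seriesRing using ()
  renaming (_≈_ to _≈₁_; _+_ to _+₁_; _*_ to _*₁_; _-_ to _-₁_; 0# to 0₁; 1# to 1₁)
open import Algebra.Properties.Semiring.Exp (CommutativeRing.semiring ℚ-ring) using (_^_)

E₁-coeffℚ : ∀ f n → E₁ f n ≡ ℕ→ℚ n ℚ.* f n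
E₁-coeffℚ f n = ≡.trans (E₁-coeff f n) (×≡ℕ→ℚ* n (f n))

E₁-kernel : ∀ f → E₁ f ≈₁ 0₁ → f ≈₁ constₛ (f 0)
E₁-kernel f E₁f≈0 zero    = ≡.refl
E₁-kernel f E₁f≈0 (suc n) = ℕ→ℚ-cancelˡ n (begin
  ℕ→ℚ (suc n) ℚ.* f (suc n)  ≡⟨ E₁-coeffℚ f (suc n) ⟨
  E₁ f (suc n)               ≡⟨ E₁f≈0 (suc n) ⟩
  0ℚ                         ≡⟨ ℚ.*-zeroʳ (ℕ→ℚ (suc n)) ⟨
  ℕ→ℚ (suc n) ℚ.* 0ℚ         ∎)
  where open ≡.≡-Reasoning

A : S₁.Series
A k = ℕ→ℚ (central k)

√[1-4x] : S₁.Series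
√[1-4x] k = gbinom ½ k ℚ.* (ℚ.- ℕ→ℚ 4) ^ k

½[1-√[1-4x]] : S₁.Series
½[1-√[1-4x]] = ½ · (1₁ -₁ √[1-4x])

A-rec : ∀ k → ℕ→ℚ (suc k) ℚ.* A (suc k) ≡ (ℕ→ℚ 4 ℚ.* ℕ→ℚ k ℚ.+ ℕ→ℚ 2) ℚ.* A k
A-rec k = begin
  ℕ→ℚ (suc k) ℚ.* A (suc k)              ≡⟨ ℕ→ℚ-* (suc k) (central (suc k)) ⟨
  ℕ→ℚ (suc k ℕ.* central (suc k))        ≡⟨ ≡.cong ℕ→ℚ (central-rec k) ⟩
  ℕ→ℚ ((4 ℕ.* k ℕ.+ 2) ℕ.* central k)    ≡⟨ ℕ→ℚ-* (4 ℕ.* k ℕ.+ 2) (central k) ⟩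
  ℕ→ℚ (4 ℕ.* k ℕ.+ 2) ℚ.* A k            ≡⟨ ≡.cong (ℚ._* A k) (≡.trans (ℕ→ℚ-+ (4 ℕ.* k) 2)
                                                                        (≡.cong (ℚ._+ ℕ→ℚ 2) (ℕ→ℚ-* 4 k))) ⟩
  (ℕ→ℚ 4 ℚ.* ℕ→ℚ k ℚ.+ ℕ→ℚ 2) ℚ.* A k    ∎
  where open ≡.≡-Reasoning

√[1-4x]-step : ∀ k → ℕ→ℚ (suc k) ℚ.* √[1-4x] (suc k) ≡ (ℕ→ℚ 4 ℚ.* ℕ→ℚ k ℚ.- ℕ→ℚ 2) ℚ.* √[1-4x] k
√[1-4x]-step k = ≡.trans
  (solve 5 (λ N g K i p → N :* ((g :* (con ½ :- K) :* i) :* (con (ℚ.- ℕ→ℚ 4) :* p))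
                        := i :* (N :* ((con (ℕ→ℚ 4) :* K :- con (ℕ→ℚ 2)) :* (g :* p))))
         ≡.refl (ℕ→ℚ (suc k)) (gbinom ½ k) (ℕ→ℚ k) (inv (suc k)) ((ℚ.- ℕ→ℚ 4) ^ k))
  (inv-*-ℕ→ℚ-* (suc k) _)
  where open ℚ-Solver

√[1-4x]-rec : ∀ k → ℕ→ℚ (suc k) ℚ.* √[1-4x] (suc k) ≡ ℚ.- ℕ→ℚ 2 ℚ.* A k
√[1-4x]-rec zero    = ≡.refl
√[1-4x]-rec (suc k) = ℕ→ℚ-cancelˡ k (begin
  N ℚ.* (ℕ→ℚ (suc (suc k)) ℚ.* √[1-4x] (suc (suc k)))
    ≡⟨ ≡.cong (N ℚ.*_) (√[1-4x]-step (suc k)) ⟩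
  N ℚ.* ((ℕ→ℚ 4 ℚ.* N ℚ.- ℕ→ℚ 2) ℚ.* √[1-4x] (suc k))
    ≡⟨ solve 3 (λ N c s → N :* (c :* s) := c :* (N :* s)) ≡.refl N (ℕ→ℚ 4 ℚ.* N ℚ.- ℕ→ℚ 2) (√[1-4x] (suc k)) ⟩
  (ℕ→ℚ 4 ℚ.* N ℚ.- ℕ→ℚ 2) ℚ.* (N ℚ.* √[1-4x] (suc k))
    ≡⟨ ≡.cong₂ ℚ._*_ 4N-2≡4K+2 (√[1-4x]-rec k) ⟩
  (ℕ→ℚ 4 ℚ.* K ℚ.+ ℕ→ℚ 2) ℚ.* (ℚ.- ℕ→ℚ 2 ℚ.* A k)
    ≡⟨ solve 2 (λ c a → c :* (con (ℚ.- ℕ→ℚ 2) :* a) := con (ℚ.- ℕ→ℚ 2) :* (c :* a)) ≡.refl (ℕ→ℚ 4 ℚ.* K ℚ.+ ℕ→ℚ 2) (A k) ⟩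
  ℚ.- ℕ→ℚ 2 ℚ.* ((ℕ→ℚ 4 ℚ.* K ℚ.+ ℕ→ℚ 2) ℚ.* A k)
    ≡⟨ ≡.cong (ℚ.- ℕ→ℚ 2 ℚ.*_) (A-rec k) ⟨
  ℚ.- ℕ→ℚ 2 ℚ.* (N ℚ.* A (suc k))
    ≡⟨ solve 2 (λ N a → con (ℚ.- ℕ→ℚ 2) :* (N :* a) := N :* (con (ℚ.- ℕ→ℚ 2) :* a)) ≡.refl N (A (suc k)) ⟩
  N ℚ.* (ℚ.- ℕ→ℚ 2 ℚ.* A (suc k))
    ∎)
  where
  open ≡.≡-Reasoning
  open ℚ-Solver
  N = ℕ→ℚ (suc k)
  K = ℕ→ℚ k
  4N-2≡4K+2 : ℕ→ℚ 4 ℚ.* N ℚ.- ℕ→ℚ 2 ≡ ℕ→ℚ 4 ℚ.* K ℚ.+ ℕ→ℚ 2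
  4N-2≡4K+2 = ≡.trans (≡.cong (λ n → ℕ→ℚ 4 ℚ.* n ℚ.- ℕ→ℚ 2) (ℕ→ℚ-suc k))
    (solve 1 (λ K → con (ℕ→ℚ 4) :* (con 1ℚ :+ K) :- con (ℕ→ℚ 2) := con (ℕ→ℚ 4) :* K :+ con (ℕ→ℚ 2)) ≡.refl K)

c*[X*f]-suc : ∀ c f k → (constₛ c *₁ (X *₁ f)) (suc k) ≡ c ℚ.* f k
c*[X*f]-suc c f k = ≡.trans (S₁.constₛ-*ₛ c (X *₁ f) (suc k)) (≡.cong (c ℚ.*_) (S₁.X-*ₛ-suc f k))

E₁√[1-4x]≈-2XA : E₁ √[1-4x] ≈₁ constₛ (ℚ.- ℕ→ℚ 2) *₁ (X *₁ A)
E₁√[1-4x]≈-2XA zero    = ≡.refl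
E₁√[1-4x]≈-2XA (suc k) = ≡.trans (E₁-coeffℚ √[1-4x] (suc k))
  (≡.trans (√[1-4x]-rec k) (≡.sym (c*[X*f]-suc (ℚ.- ℕ→ℚ 2) A k)))

[1-4X]E₁A≈2XA : E₁ A -₁ constₛ (ℕ→ℚ 4) *₁ (X *₁ E₁ A) ≈₁ constₛ (ℕ→ℚ 2) *₁ (X *₁ A)
[1-4X]E₁A≈2XA zero    = ≡.refl
[1-4X]E₁A≈2XA (suc k) = begin
  E₁ A (suc k) ℚ.- (constₛ (ℕ→ℚ 4) *₁ (X *₁ E₁ A)) (suc k)
    ≡⟨ ≡.cong₂ ℚ._-_ (E₁-coeffℚ A (suc k))
                      (≡.trans (c*[X*f]-suc (ℕ→ℚ 4) (E₁ A) k) (≡.cong (ℕ→ℚ 4 ℚ.*_) (E₁-coeffℚ A k))) ⟩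
  ℕ→ℚ (suc k) ℚ.* A (suc k) ℚ.- ℕ→ℚ 4 ℚ.* (K ℚ.* A k)
    ≡⟨ ≡.cong (ℚ._- ℕ→ℚ 4 ℚ.* (K ℚ.* A k)) (A-rec k) ⟩
  (ℕ→ℚ 4 ℚ.* K ℚ.+ ℕ→ℚ 2) ℚ.* A k ℚ.- ℕ→ℚ 4 ℚ.* (K ℚ.* A k)
    ≡⟨ solve 2 (λ K a → (con (ℕ→ℚ 4) :* K :+ con (ℕ→ℚ 2)) :* a :- con (ℕ→ℚ 4) :* (K :* a) := con (ℕ→ℚ 2) :* a)
               ≡.refl K (A k) ⟩
  ℕ→ℚ 2 ℚ.* A k
    ≡⟨ c*[X*f]-suc (ℕ→ℚ 2) A k ⟨
  (constₛ (ℕ→ℚ 2) *₁ (X *₁ A)) (suc k)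
    ∎
  where
  open ≡.≡-Reasoning
  open ℚ-Solver
  K = ℕ→ℚ k

√[1-4x]≈[1-4x]A : √[1-4x] ≈₁ A -₁ constₛ (ℕ→ℚ 4) *₁ (X *₁ A)
√[1-4x]≈[1-4x]A zero    = ≡.refl
√[1-4x]≈[1-4x]A (suc k) = ℕ→ℚ-cancelˡ k (begin
  N ℚ.* √[1-4x] (suc k)
    ≡⟨ √[1-4x]-rec k ⟩
  ℚ.- ℕ→ℚ 2 ℚ.* A k
    ≡⟨ solve 2 (λ K a → con (ℚ.- ℕ→ℚ 2) :* a
                        := (con (ℕ→ℚ 4) :* K :+ con (ℕ→ℚ 2)) :* a :- (con 1ℚ :+ K) :* (con (ℕ→ℚ 4) :* a))
               ≡.refl K (A k) ⟩
  (ℕ→ℚ 4 ℚ.* K ℚ.+ ℕ→ℚ 2) ℚ.* A k ℚ.- (1ℚ ℚ.+ K) ℚ.* (ℕ→ℚ 4 ℚ.* A k)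
    ≡⟨ ≡.cong₂ (λ u v → u ℚ.- v ℚ.* (ℕ→ℚ 4 ℚ.* A k)) (A-rec k) (ℕ→ℚ-suc k) ⟨
  N ℚ.* A (suc k) ℚ.- N ℚ.* (ℕ→ℚ 4 ℚ.* A k)
    ≡⟨ solve 3 (λ N a b → N :* a :- N :* b := N :* (a :- b)) ≡.refl N (A (suc k)) (ℕ→ℚ 4 ℚ.* A k) ⟩
  N ℚ.* (A (suc k) ℚ.- ℕ→ℚ 4 ℚ.* A k)
    ≡⟨ ≡.cong (λ u → N ℚ.* (A (suc k) ℚ.- u)) (c*[X*f]-suc (ℕ→ℚ 4) A k) ⟨
  N ℚ.* (A -₁ constₛ (ℕ→ℚ 4) *₁ (X *₁ A)) (suc k)
    ∎)
  where
  open ≡.≡-Reasoning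
  open ℚ-Solver
  N = ℕ→ℚ (suc k)
  K = ℕ→ℚ k

E₁½[1-√[1-4x]]≈XA : E₁ ½[1-√[1-4x]] ≈₁ X *₁ A
E₁½[1-√[1-4x]]≈XA zero    = ≡.refl
E₁½[1-√[1-4x]]≈XA (suc k) = begin
  E₁ ½[1-√[1-4x]] (suc k)                   ≡⟨ E₁-coeffℚ ½[1-√[1-4x]] (suc k) ⟩
  N ℚ.* (½ ℚ.* (0ℚ ℚ.- √[1-4x] (suc k)))    ≡⟨ solve 2 (λ N s → N :* (con ½ :* (con 0ℚ :- s)) := con (ℚ.- ½) :* (N :* s))
                                                      ≡.refl N (√[1-4x] (suc k)) ⟩
  ℚ.- ½ ℚ.* (N ℚ.* √[1-4x] (suc k))         ≡⟨ ≡.cong (ℚ.- ½ ℚ.*_) (√[1-4x]-rec k) ⟩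
  ℚ.- ½ ℚ.* (ℚ.- ℕ→ℚ 2 ℚ.* A k)             ≡⟨ solve 1 (λ a → con (ℚ.- ½) :* (con (ℚ.- ℕ→ℚ 2) :* a) := a) ≡.refl (A k) ⟩
  A k                                       ≡⟨ S₁.X-*ₛ-suc A k ⟨
  (X *₁ A) (suc k)                          ∎
  where
  open ≡.≡-Reasoning
  open ℚ-Solver
  N = ℕ→ℚ (suc k)

√[1-4x]*A≈1 : √[1-4x] *₁ A ≈₁ 1₁
√[1-4x]*A≈1 = E₁-kernel (√[1-4x] *₁ A) (begin
  E₁ (√[1-4x] *₁ A)
    ≈⟨ Derivation.leibniz euler₁ √[1-4x] A ⟩
  E₁ √[1-4x] *₁ A +₁ √[1-4x] *₁ E₁ A
    ≈⟨ +-cong (*-congʳ {A} E₁√[1-4x]≈-2XA) (*-congʳ {E₁ A} √[1-4x]≈[1-4x]A) ⟩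
  c (ℚ.- ℕ→ℚ 2) *₁ (X *₁ A) *₁ A +₁ (A -₁ c (ℕ→ℚ 4) *₁ (X *₁ A)) *₁ E₁ A
    ≈⟨ solve 3 (λ x a e → con (ℚ.- ℕ→ℚ 2) :* (x :* a) :* a :+ (a :- con (ℕ→ℚ 4) :* (x :* a)) :* e
                        := con (ℚ.- ℕ→ℚ 2) :* (x :* a) :* a :+ a :* (e :- con (ℕ→ℚ 4) :* (x :* e)))
               refl X A (E₁ A) ⟩
  c (ℚ.- ℕ→ℚ 2) *₁ (X *₁ A) *₁ A +₁ A *₁ (E₁ A -₁ c (ℕ→ℚ 4) *₁ (X *₁ E₁ A))
    ≈⟨ +-congˡ {c (ℚ.- ℕ→ℚ 2) *₁ (X *₁ A) *₁ A} (*-congˡ {A} [1-4X]E₁A≈2XA) ⟩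
  c (ℚ.- ℕ→ℚ 2) *₁ (X *₁ A) *₁ A +₁ A *₁ (c (ℕ→ℚ 2) *₁ (X *₁ A))
    ≈⟨ solve 2 (λ x a → con (ℚ.- ℕ→ℚ 2) :* (x :* a) :* a :+ a :* (con (ℕ→ℚ 2) :* (x :* a)) := con 0ℚ)
               refl X A ⟩
  c 0ℚ
    ≈⟨ IsRingHomomorphism.0#-homo S₁.constₛ-isRingHomomorphism ⟩
  0₁
    ∎)
  where
  open CommutativeRing S₁.seriesRing using (refl; +-cong; +-congˡ; *-congʳ; *-congˡ; setoid)
  open import Relation.Binary.Reasoning.Setoid setoid
  open S₁-Solver
  c = constₛ

open CommutativeRing S₂.seriesRing using ()
  renaming (_≈_ to _≈₂_; _+_ to _+₂_; _*_ to _*₂_; _-_ to _-₂_; 1# to 1₂; trans to ≈₂-trans; sym to ≈₂-sym)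
open import Algebra.Properties.Semiring.Exp (CommutativeRing.semiring S₁.seriesRing)
  using () renaming (_^_ to _^₁_)
open import Algebra.Properties.Semiring.Exp (CommutativeRing.semiring S₂.seriesRing)
  using () renaming (_^_ to _^₂_; ^-congˡ to ^₂-congˡ)

sumTo≡Σ≤ : ∀ n f → sumTo n f ≡ Σ≤ n f
sumTo≡Σ≤ zero    f = ≡.refl
sumTo≡Σ≤ (suc n) f = ≡.cong (ℚ._+ f (suc n)) (sumTo≡Σ≤ n f)

⊛≡*₂ : ∀ F G r s → (F ⊛ G) r s ≡ (F *₂ G) r s
⊛≡*₂ F G r s = ≡.trans (sumTo≡Σ≤ r _)
  (≡.trans (Σ≤-cong r (λ i _ → sumTo≡Σ≤ s _)) (≡.sym (*₂-coeff F G r s)))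

pow≈^₂ : ∀ F k → pow F k ≈₂ F ^₂ k
pow≈^₂ F zero    zero    zero    = ≡.refl
pow≈^₂ F zero    zero    (suc s) = ≡.refl
pow≈^₂ F zero    (suc r) s       = ≡.refl
pow≈^₂ F (suc k) r s = ≡.trans (⊛≡*₂ F (pow F k) r s) (S₂.*ₛ-cong {F} {F} (λ _ _ → ≡.refl) (pow≈^₂ F k) r s)

-4X : S₁.Series
-4X = (ℚ.- ℕ→ℚ 4) · X

[1-4p]-1 [1-4q]-1 : Series₂
[1-4p]-1 = (const 1ℚ ⊖ scale (ℕ→ℚ 4) varP) ⊖ const 1ℚ
[1-4q]-1 = (const 1ℚ ⊖ scale (ℕ→ℚ 4) varQ) ⊖ const 1ℚ

[1-4p]-1≈embedP[-4X] : [1-4p]-1 ≈₂ embedP -4X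
[1-4p]-1≈embedP[-4X] zero          zero    = ≡.refl
[1-4p]-1≈embedP[-4X] zero          (suc s) = ≡.refl
[1-4p]-1≈embedP[-4X] (suc zero)    zero    = ≡.refl
[1-4p]-1≈embedP[-4X] (suc zero)    (suc s) = ≡.refl
[1-4p]-1≈embedP[-4X] (suc (suc r)) zero    = ≡.refl
[1-4p]-1≈embedP[-4X] (suc (suc r)) (suc s) = ≡.refl

[1-4q]-1≈embedQ[-4X] : [1-4q]-1 ≈₂ embedQ -4X
[1-4q]-1≈embedQ[-4X] zero    zero          = ≡.refl
[1-4q]-1≈embedQ[-4X] zero    (suc zero)    = ≡.refl
[1-4q]-1≈embedQ[-4X] zero    (suc (suc s)) = ≡.refl
[1-4q]-1≈embedQ[-4X] (suc r) s             = ≡.refl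

pow-embedP : ∀ {G} f → G ≈₂ embedP f → ∀ k → pow G k ≈₂ embedP (f ^₁ k)
pow-embedP {G} f G≈Pf k = ≈₂-trans (pow≈^₂ G k)
  (≈₂-trans (^₂-congˡ k G≈Pf) (≈₂-sym (^-homo S₁.seriesRing S₂.seriesRing embedP-isRingHomomorphism f k)))

pow-embedQ : ∀ {G} f → G ≈₂ embedQ f → ∀ k → pow G k ≈₂ embedQ (f ^₁ k)
pow-embedQ {G} f G≈Qf k = ≈₂-trans (pow≈^₂ G k)
  (≈₂-trans (^₂-congˡ k G≈Qf) (≈₂-sym (^-homo S₁.seriesRing S₂.seriesRing S₂.constₛ-isRingHomomorphism f k)))

compose≡Σ≤ : ∀ a G r s → compose a G r s ≡ Σ≤ (r ℕ.+ s) (λ k → a k ℚ.* pow G k r s)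
compose≡Σ≤ a G r s = sumTo≡Σ≤ (r ℕ.+ s) (λ k → a k ℚ.* pow G k r s)

Σ≤-gbinom-[-4X]^ : ∀ n m → m ≤ n → Σ≤ n (λ k → gbinom ½ k ℚ.* (-4X ^₁ k) m) ≡ √[1-4x] m
Σ≤-gbinom-[-4X]^ n m m≤n = ≡.trans
  (Σ≤-single n m (λ k → gbinom ½ k ℚ.* (-4X ^₁ k) m) m≤n (λ k _ k≢m → ≡.trans
    (≡.cong (gbinom ½ k ℚ.*_) (S₁.·X-^-off (ℚ.- ℕ→ℚ 4) k m (λ m≡k → k≢m (≡.sym m≡k))))
    (ℚ.*-zeroʳ (gbinom ½ k))))
  (≡.cong (gbinom ½ m ℚ.*_) (S₁.·X-^-diag (ℚ.- ℕ→ℚ 4) m))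

sqrtS[1-4p] : sqrtS (const 1ℚ ⊖ scale (ℕ→ℚ 4) varP) ≈₂ embedP √[1-4x]
sqrtS[1-4p] r zero    = ≡.trans (compose≡Σ≤ (gbinom ½) [1-4p]-1 r 0) (≡.trans
  (Σ≤-cong (r ℕ.+ 0) (λ k _ → ≡.cong (gbinom ½ k ℚ.*_) (pow-embedP -4X [1-4p]-1≈embedP[-4X] k r 0)))
  (Σ≤-gbinom-[-4X]^ (r ℕ.+ 0) r (ℕ.m≤m+n r 0)))
sqrtS[1-4p] r (suc s) = ≡.trans (compose≡Σ≤ (gbinom ½) [1-4p]-1 r (suc s)) (Σ≤-zero (r ℕ.+ suc s) _ (λ k _ →
  ≡.trans (≡.cong (gbinom ½ k ℚ.*_) (pow-embedP -4X [1-4p]-1≈embedP[-4X] k r (suc s))) (ℚ.*-zeroʳ (gbinom ½ k))))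

sqrtS[1-4q] : sqrtS (const 1ℚ ⊖ scale (ℕ→ℚ 4) varQ) ≈₂ embedQ √[1-4x]
sqrtS[1-4q] zero    s = ≡.trans (compose≡Σ≤ (gbinom ½) [1-4q]-1 0 s) (≡.trans
  (Σ≤-cong s (λ k _ → ≡.cong (gbinom ½ k ℚ.*_) (pow-embedQ -4X [1-4q]-1≈embedQ[-4X] k 0 s)))
  (Σ≤-gbinom-[-4X]^ s s ℕ.≤-refl))
sqrtS[1-4q] (suc r) s = ≡.trans (compose≡Σ≤ (gbinom ½) [1-4q]-1 (suc r) s) (Σ≤-zero (suc r ℕ.+ s) _ (λ k _ →
  ≡.trans (≡.cong (gbinom ½ k ℚ.*_) (pow-embedQ -4X [1-4q]-1≈embedQ[-4X] k (suc r) s)) (ℚ.*-zeroʳ (gbinom ½ k))))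

B≈embedP+embedQ : B ≈₂ embedP ½[1-√[1-4x]] +₂ embedQ ½[1-√[1-4x]]
B≈embedP+embedQ r s = ≡.cong₂ ℚ._+_
  (≡.trans (≡.cong (λ z → ½ ℚ.* (const 1ℚ r s ℚ.- z)) (sqrtS[1-4p] r s)) (p-part r s))
  (≡.trans (≡.cong (λ z → ½ ℚ.* (const 1ℚ r s ℚ.- z)) (sqrtS[1-4q] r s)) (q-part r s))
  where
  p-part : ∀ r s → ½ ℚ.* (const 1ℚ r s ℚ.- embedP √[1-4x] r s) ≡ embedP ½[1-√[1-4x]] r s
  p-part zero    zero    = ≡.refl
  p-part (suc r) zero    = ≡.refl
  p-part zero    (suc s) = ≡.refl
  p-part (suc r) (suc s) = ≡.refl
  q-part : ∀ r s → ½ ℚ.* (const 1ℚ r s ℚ.- embedQ √[1-4x] r s) ≡ embedQ ½[1-√[1-4x]] r s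
  q-part zero    zero    = ≡.refl
  q-part zero    (suc s) = ≡.refl
  q-part (suc r) s       = ≡.refl

module EmbeddedIdentities
  {φ : S₁.Series → Series₂}
  (φ-hom : IsRingHomomorphism (CommutativeRing.rawRing S₁.seriesRing) (CommutativeRing.rawRing S₂.seriesRing) φ)
  (φ-constₛ : ∀ q → φ (constₛ q) ≈₂ const₂ q)
  (φ-E : ∀ f → E₂ (φ f) ≈₂ φ (E₁ f))
  where
  open IsRingHomomorphism φ-hom
  open CommutativeRing S₂.seriesRing using (refl; sym; trans; setoid; +-cong; +-congˡ; *-cong; -‿cong)
  open import Relation.Binary.Reasoning.Setoid setoid

  sub-homo : ∀ f g → φ (f -₁ g) ≈₂ φ f -₂ φ g
  sub-homo f g = trans (+-homo f _) (+-congˡ {φ f} (-‿homo g))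

  φ√*φA≈1 : φ √[1-4x] *₂ φ A ≈₂ 1₂
  φ√*φA≈1 = trans (sym (*-homo _ _)) (trans (⟦⟧-cong √[1-4x]*A≈1) 1#-homo)

  φ√≈[1-4φX]φA : φ √[1-4x] ≈₂ φ A -₂ const₂ (ℕ→ℚ 4) *₂ (φ X *₂ φ A)
  φ√≈[1-4φX]φA = begin
    φ √[1-4x]                              ≈⟨ ⟦⟧-cong √[1-4x]≈[1-4x]A ⟩
    φ (A -₁ constₛ (ℕ→ℚ 4) *₁ (X *₁ A))     ≈⟨ sub-homo _ _ ⟩
    φ A -₂ φ (constₛ (ℕ→ℚ 4) *₁ (X *₁ A))
      ≈⟨ +-congˡ {φ A} (-‿cong (trans (*-homo _ _) (*-cong (φ-constₛ (ℕ→ℚ 4)) (*-homo _ _)))) ⟩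
    φ A -₂ const₂ (ℕ→ℚ 4) *₂ (φ X *₂ φ A) ∎

  φ½[1-√]≈ : φ ½[1-√[1-4x]] ≈₂ const₂ ½ *₂ (1₂ -₂ φ √[1-4x])
  φ½[1-√]≈ = begin
    φ ½[1-√[1-4x]]                        ≈⟨ ⟦⟧-cong (λ n → ≡.sym (S₁.constₛ-*ₛ ½ (1₁ -₁ √[1-4x]) n)) ⟩
    φ (constₛ ½ *₁ (1₁ -₁ √[1-4x]))       ≈⟨ *-homo _ _ ⟩
    φ (constₛ ½) *₂ φ (1₁ -₁ √[1-4x])     ≈⟨ *-cong (φ-constₛ ½) (trans (sub-homo _ _) (+-cong 1#-homo refl)) ⟩
    const₂ ½ *₂ (1₂ -₂ φ √[1-4x])         ∎

  E₂φ½[1-√]≈φXφA : E₂ (φ ½[1-√[1-4x]]) ≈₂ φ X *₂ φ A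
  E₂φ½[1-√]≈φXφA = trans (φ-E ½[1-√[1-4x]]) (trans (⟦⟧-cong E₁½[1-√[1-4x]]≈XA) (*-homo _ _))

module P = EmbeddedIdentities embedP-isRingHomomorphism embedP-constₛ E₂-embedP
module Q = EmbeddedIdentities S₂.constₛ-isRingHomomorphism (λ _ _ _ → ≡.refl) E₂-embedQ

½[ApAq-1] : Series₂
½[ApAq-1] = const₂ ½ *₂ (embedP A *₂ embedQ A -₂ 1₂)

E₂B≈[1-B]*½[ApAq-1] : E₂ B ≈₂ (1₂ -₂ B) *₂ ½[ApAq-1]
E₂B≈[1-B]*½[ApAq-1] = sym (begin
  (1₂ -₂ B) *₂ ½[ApAq-1]
    ≈⟨ *-congʳ {½[ApAq-1]} (+-congˡ {1₂} (-‿cong (trans B≈embedP+embedQ (+-cong P.φ½[1-√]≈ Q.φ½[1-√]≈)))) ⟩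
  (1₂ -₂ (const₂ ½ *₂ (1₂ -₂ u) +₂ const₂ ½ *₂ (1₂ -₂ v))) *₂ ½[ApAq-1]
    ≈⟨ solve 4 (λ u v α β → (con 1ℚ :- (con ½ :* (con 1ℚ :- u) :+ con ½ :* (con 1ℚ :- v)))
                            :* (con ½ :* (α :* β :- con 1ℚ))
                          := con ¼ :* ((u :* α) :* β :+ (v :* β) :* α :- u :- v))
               refl u v α β ⟩
  const₂ ¼ *₂ ((u *₂ α) *₂ β +₂ (v *₂ β) *₂ α -₂ u -₂ v)
    ≈⟨ *-congˡ {const₂ ¼} (+-cong (+-cong (+-cong (*-congʳ {β} P.φ√*φA≈1) (*-congʳ {α} Q.φ√*φA≈1))
                                        (-‿cong P.φ√≈[1-4φX]φA))
                                (-‿cong Q.φ√≈[1-4φX]φA)) ⟩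
  const₂ ¼ *₂ (1₂ *₂ β +₂ 1₂ *₂ α -₂ (α -₂ const₂ (ℕ→ℚ 4) *₂ (x *₂ α)) -₂ (β -₂ const₂ (ℕ→ℚ 4) *₂ (y *₂ β)))
    ≈⟨ solve 4 (λ x y α β → con ¼ :* (con 1ℚ :* β :+ con 1ℚ :* α :- (α :- con (ℕ→ℚ 4) :* (x :* α))
                                                                  :- (β :- con (ℕ→ℚ 4) :* (y :* β)))
                          := x :* α :+ y :* β)
               refl x y α β ⟩
  x *₂ α +₂ y *₂ β
    ≈⟨ +-cong P.E₂φ½[1-√]≈φXφA Q.E₂φ½[1-√]≈φXφA ⟨
  E₂ (embedP ½[1-√[1-4x]]) +₂ E₂ (embedQ ½[1-√[1-4x]])
    ≈⟨ Derivation.D-+ euler₂ _ _ ⟨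
  E₂ (embedP ½[1-√[1-4x]] +₂ embedQ ½[1-√[1-4x]])
    ≈⟨ Derivation.D-cong euler₂ B≈embedP+embedQ ⟨
  E₂ B ∎)
  where
  open CommutativeRing S₂.seriesRing
    using (refl; sym; trans; setoid; +-cong; +-congˡ; *-congˡ; *-congʳ; -‿cong)
  open import Relation.Binary.Reasoning.Setoid setoid
  open S₂-Solver
  ¼ : ℚ
  ¼ = ½ ℚ.* ½
  u = embedP √[1-4x]
  v = embedQ √[1-4x]
  α = embedP A
  β = embedQ A
  x = embedP X
  y = embedQ X

E₂-coeffℚ : ∀ F r s → E₂ F r s ≡ ℕ→ℚ (r ℕ.+ s) ℚ.* F r s
E₂-coeffℚ F r s = ≡.trans (E₂-coeff F r s) (×≡ℕ→ℚ* (r ℕ.+ s) (F r s))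

E₂-^-coeff : ∀ F m r s → E₂ (F ^₂ suc m) r s ≡ ℕ→ℚ (suc m) ℚ.* (F ^₂ m *₂ E₂ F) r s
E₂-^-coeff F m r s = ≡.trans (DerivationProperties.D-^ euler₂ F m r s)
  (≡.trans (S₂.×ₛ-coeff (suc m) (F ^₂ m *₂ E₂ F) r s)
    (≡.trans (S₁.×ₛ-coeff (suc m) ((F ^₂ m *₂ E₂ F) r) s) (×≡ℕ→ℚ* (suc m) _)))

-- log(1/(1-G)) is the truncated sum Σ_{k ≤ r+s} Gᵏ/k; as E(Gᵏ)/k = Gᵏ⁻¹·E G, the sum of
-- the (r,s)-coefficients telescopes to those of (1 - Gʳ⁺ˢ)·Y, and Gʳ⁺ˢ·Y has order r+s+1.
module _ {G Y : Series₂} (G-order : HasOrder 1 G) (Y-order : HasOrder 1 Y)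
         (E₂G≈[1-G]Y : E₂ G ≈₂ (1₂ -₂ G) *₂ Y) (r s : ℕ) where
  open CommutativeRing S₂.seriesRing using (*-congˡ; +-congʳ; distribʳ; zeroˡ; trans; setoid)

  private
    n : ℕ
    n = r ℕ.+ s

    logTerm : ℕ → ℚ
    logTerm k = inv k ℚ.* E₂ (G ^₂ k) r s

    n*logTerm : ∀ k → ℕ→ℚ n ℚ.* (inv k ℚ.* pow G k r s) ≡ logTerm k
    n*logTerm k = begin
      ℕ→ℚ n ℚ.* (inv k ℚ.* pow G k r s)       ≡⟨ ≡.cong (λ z → ℕ→ℚ n ℚ.* (inv k ℚ.* z)) (pow≈^₂ G k r s) ⟩
      ℕ→ℚ n ℚ.* (inv k ℚ.* (G ^₂ k) r s)      ≡⟨ solve 3 (λ a b c → a :* (b :* c) := b :* (a :* c))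
                                                       ≡.refl (ℕ→ℚ n) (inv k) ((G ^₂ k) r s) ⟩
      inv k ℚ.* (ℕ→ℚ n ℚ.* (G ^₂ k) r s)      ≡⟨ ≡.cong (inv k ℚ.*_) (E₂-coeffℚ (G ^₂ k) r s) ⟨
      logTerm k                              ∎
      where
      open ≡.≡-Reasoning
      open ℚ-Solver

    Σ≤-logTerm : ∀ N → Σ≤ N logTerm ≡ (geometricSum S₂.seriesRing G N *₂ E₂ G) r s
    -- The k = 0 term vanishes because inv 0 = 0.
    Σ≤-logTerm zero    = ≡.trans (ℚ.*-zeroˡ (E₂ (G ^₂ 0) r s)) (≡.sym (zeroˡ (E₂ G) r s))
    Σ≤-logTerm (suc N) = ≡.trans
      (≡.cong₂ ℚ._+_ (Σ≤-logTerm N) (≡.trans (≡.cong (inv (suc N) ℚ.*_) (E₂-^-coeff G N r s)) (inv-*-ℕ→ℚ-* (suc N) _)))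
      (≡.sym (distribʳ (E₂ G) (geometricSum S₂.seriesRing G N) (G ^₂ N) r s))

    geometricSum*E₂G≈ : geometricSum S₂.seriesRing G n *₂ E₂ G ≈₂ Y -₂ G ^₂ n *₂ Y
    geometricSum*E₂G≈ = begin
      g *₂ E₂ G                         ≈⟨ *-congˡ {g} E₂G≈[1-G]Y ⟩
      g *₂ ((1₂ -₂ G) *₂ Y)             ≈⟨ solve 4 (λ g G Gⁿ Y → g :* ((con 1ℚ :- G) :* Y)
                                                       := (g :* (con 1ℚ :- G) :+ Gⁿ) :* Y :- Gⁿ :* Y)
                                                refl g G (G ^₂ n) Y ⟩
      (g *₂ (1₂ -₂ G) +₂ G ^₂ n) *₂ Y -₂ G ^₂ n *₂ Y
        ≈⟨ +-congʳ (*-congʳ {Y} (geometricSum-telescope S₂.seriesRing G n)) ⟩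
      1₂ *₂ Y -₂ G ^₂ n *₂ Y            ≈⟨ solve 2 (λ Gⁿ Y → con 1ℚ :* Y :- Gⁿ :* Y := Y :- Gⁿ :* Y) refl (G ^₂ n) Y ⟩
      Y -₂ G ^₂ n *₂ Y                  ∎
      where
      open CommutativeRing S₂.seriesRing using (refl; *-congʳ)
      open import Relation.Binary.Reasoning.Setoid setoid
      open S₂-Solver
      g = geometricSum S₂.seriesRing G n

  n*logInvOneMinus≡ : ℕ→ℚ n ℚ.* logInvOneMinus G r s ≡ Y r s
  n*logInvOneMinus≡ = begin
    ℕ→ℚ n ℚ.* sumTo n (λ k → inv k ℚ.* pow G k r s)     ≡⟨ ≡.cong (ℕ→ℚ n ℚ.*_) (sumTo≡Σ≤ n _) ⟩
    ℕ→ℚ n ℚ.* Σ≤ n (λ k → inv k ℚ.* pow G k r s)        ≡⟨ Σ≤-distribˡ n (ℕ→ℚ n) _ ⟩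
    Σ≤ n (λ k → ℕ→ℚ n ℚ.* (inv k ℚ.* pow G k r s))      ≡⟨ Σ≤-cong n (λ k _ → n*logTerm k) ⟩
    Σ≤ n logTerm                                         ≡⟨ Σ≤-logTerm n ⟩
    (geometricSum S₂.seriesRing G n *₂ E₂ G) r s         ≡⟨ geometricSum*E₂G≈ r s ⟩
    Y r s ℚ.- (G ^₂ n *₂ Y) r s                          ≡⟨ ≡.cong (λ z → Y r s ℚ.- z) tail≡0 ⟩
    Y r s ℚ.- 0ℚ                                         ≡⟨ ℚ.+-identityʳ (Y r s) ⟩
    Y r s                                                ∎
    where
    open ≡.≡-Reasoning
    tail≡0 : (G ^₂ n *₂ Y) r s ≡ 0ℚ
    tail≡0 = hasOrder-* (hasOrder-^ G-order n) Y-order r s (ℕ.m<m+n n (s≤s z≤n))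

B-order : HasOrder 1 B
B-order zero    zero    _ = ≡.refl
B-order zero    (suc s) (s≤s ())
B-order (suc r) s       (s≤s ())

½[ApAq-1]-order : HasOrder 1 ½[ApAq-1]
½[ApAq-1]-order zero    zero    _ = ≡.refl
½[ApAq-1]-order zero    (suc s) (s≤s ())
½[ApAq-1]-order (suc r) s       (s≤s ())

open import Data.Product using (_×_)

½[ApAq-1]-coeff : ∀ r s → ¬ (r ≡ 0 × s ≡ 0) → ½[ApAq-1] r s ≡ ½ ℚ.* (A r ℚ.* A s)
½[ApAq-1]-coeff r s not-both-zero = begin
  ½[ApAq-1] r s                    ≡⟨ S₂.constₛ-*ₛ (constₛ ½) AA-1 r s ⟩
  (constₛ ½ *₁ AA-1 r) s           ≡⟨ S₁.constₛ-*ₛ ½ (AA-1 r) s ⟩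
  ½ ℚ.* ((α *₂ β) r s ℚ.- 1₂ r s)  ≡⟨ ≡.cong₂ (λ u v → ½ ℚ.* (u ℚ.- v)) αβ-coeff (1₂-coeff r s not-both-zero) ⟩
  ½ ℚ.* (A r ℚ.* A s ℚ.- 0ℚ)       ≡⟨ ≡.cong (½ ℚ.*_) (ℚ.+-identityʳ (A r ℚ.* A s)) ⟩
  ½ ℚ.* (A r ℚ.* A s)              ∎
  where
  open ≡.≡-Reasoning
  α = embedP A
  β = embedQ A
  AA-1 = α *₂ β -₂ 1₂
  αβ-coeff : (α *₂ β) r s ≡ A r ℚ.* A s
  αβ-coeff = ≡.trans (S₂.*ₛ-comm α β r s) (≡.trans (S₂.constₛ-*ₛ A α r s)
    (≡.trans (S₁.*ₛ-comm A (α r) s) (S₁.constₛ-*ₛ (A r) A s)))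
  1₂-coeff : ∀ r s → ¬ (r ≡ 0 × s ≡ 0) → 1₂ r s ≡ 0ℚ
  1₂-coeff zero    zero    not-both-zero = contradiction (≡.refl , ≡.refl) not-both-zero
  1₂-coeff zero    (suc s) _ = ≡.refl
  1₂-coeff (suc r) s       _ = ≡.refl

lemma3p3 : (r s : ℕ) → ¬ (r ≡ 0 × s ≡ 0) →
    logInvOneMinus B r s ≡ inv (2 ℕ.* (r ℕ.+ s)) ℚ.* ℕ→ℚ (((2 ℕ.* r) C r) ℕ.* ((2 ℕ.* s) C s))
lemma3p3 r s not-both-zero = begin
  L                                      ≡⟨ inv-*-ℕ→ℚ-* (2 ℕ.* n) L ⟨
  inv (2 ℕ.* n) ℚ.* (ℕ→ℚ (2 ℕ.* n) ℚ.* L) ≡⟨ ≡.cong (inv (2 ℕ.* n) ℚ.*_) 2n*L≡AA ⟩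
  inv (2 ℕ.* n) ℚ.* ℕ→ℚ (central r ℕ.* central s) ∎
  where
  open ≡.≡-Reasoning
  open ℚ-Solver
  n = r ℕ.+ s
  L = logInvOneMinus B r s
  2n*L≡AA : ℕ→ℚ (2 ℕ.* n) ℚ.* L ≡ ℕ→ℚ (central r ℕ.* central s)
  2n*L≡AA = begin
    ℕ→ℚ (2 ℕ.* n) ℚ.* L          ≡⟨ ≡.cong (ℚ._* L) (ℕ→ℚ-* 2 n) ⟩
    ℕ→ℚ 2 ℚ.* ℕ→ℚ n ℚ.* L        ≡⟨ ℚ.*-assoc (ℕ→ℚ 2) (ℕ→ℚ n) L ⟩
    ℕ→ℚ 2 ℚ.* (ℕ→ℚ n ℚ.* L)      ≡⟨ ≡.cong (ℕ→ℚ 2 ℚ.*_) (≡.trans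
                                      (n*logInvOneMinus≡ B-order ½[ApAq-1]-order E₂B≈[1-B]*½[ApAq-1] r s)
                                      (½[ApAq-1]-coeff r s not-both-zero)) ⟩
    ℕ→ℚ 2 ℚ.* (½ ℚ.* (A r ℚ.* A s)) ≡⟨ solve 1 (λ a → con (ℕ→ℚ 2) :* (con ½ :* a) := a) ≡.refl (A r ℚ.* A s) ⟩
    A r ℚ.* A s                  ≡⟨ ℕ→ℚ-* (central r) (central s) ⟨
    ℕ→ℚ (central r ℕ.* central s) ∎
  instance
    2n-nonZero : ℕ.NonZero (2 ℕ.* n)
    2n-nonZero = ℕ.≢-nonZero λ 2n≡0 → let n≡0 = ℕ.m+n≡0⇒m≡0 n 2n≡0 in
      not-both-zero (ℕ.m+n≡0⇒m≡0 r n≡0 , ℕ.m+n≡0⇒n≡0 r n≡0)
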